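{- Let $B$ be a nonempty subset of $M=\{\mathbf a\in\mathbb N^n:|\mathbf a|_1\le d\}$ and $A=\textsc{Find-Cone-closed}(B,n)$. Then the submatrix $T_{A,B}$ has full rank.
   Context: Throughout, $\mathbb F=\mathbb Q$. $T$ is the matrix with rows and columns indexed by $M$ and entries $T_{\mathbf a,\mathbf b}=\binom{\mathbf b}{\mathbf a}:=\prod_{i=1}^n\binom{b_i}{a_i}$; $T_{A,B}$ is its submatrix with rows in $A$ and columns in $B$. The procedure $\textsc{Find-Cone-closed}(B,n)$, for a nonempty finite $B\subseteq\mathbb N^n$: if $n=1$, return $\{0,1,\dots,|B|-1\}$. Otherwise, let $\pi_n:\mathbb N^n\to\mathbb N^{n-1}$ be the projection onto the first $n-1$ coordinates, let $\ell$ be the maximum size of a preimage $\pi_n^{ -1}(\mathbf e)\cap B$ over $\mathbf e\in\pi_n(B)$, and for $i\in[\ell]$ let $F_i$ be the set of $\mathbf e\in\pi_n(B)$ with $|\pi_n^{ -1}(\mathbf e)\cap B|\ge i$; set $S_i=\textsc{Find-Cone-closed}(F_i,n-1)$ and return $A=\bigcup_{i=1}^{\ell}S_i\times\{i-1\}$. -}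

module Defs where

open import Data.Nat as ℕ using (ℕ; zero; suc; _≤_; _≤?_; _⊔_)
open import Data.Nat.Combinatorics using (_C_)
open import Data.Nat.ListAction using (sum; product)
open import Data.Integer using (+_)
open import Data.Rational using (ℚ; 0ℚ; _+_; _*_; _/_)
open import Data.Fin using (Fin)
import Data.Fin as Fin
open import Data.Vec as Vec using (Vec; []; _∷_; _∷ʳ_; init; zipWith; toList)
open import Data.Vec.Properties using (≡-dec)
open import Data.List as List using (List; length; map; filter; deduplicate; applyUpTo; concat; foldr; lookup)
open import Relation.Binary.PropositionalEquality using (_≡_)
open import Relation.Nullary using (¬_)

_≟ᵥ_ : ∀ {k} → (x y : Vec ℕ k) → Relation.Nullary.Dec (x ≡ y)
_≟ᵥ_ = ≡-dec ℕ._≟_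

norm1 : ∀ {k} → Vec ℕ k → ℕ
norm1 a = sum (toList a)

binomVec : ∀ {k} → Vec ℕ k → Vec ℕ k → ℕ
binomVec b a = product (toList (zipWith _C_ b a))

Tentry : ∀ {k} → Vec ℕ k → Vec ℕ k → ℚ
Tentry a b = (+ binomVec b a) / 1

Σℚ : ∀ k → (Fin k → ℚ) → ℚ
Σℚ zero    f = 0ℚ
Σℚ (suc k) f = f Fin.zero + Σℚ k (λ i → f (Fin.suc i))

Matrix : ℕ → ℕ → Set
Matrix r c = Fin r → Fin c → ℚ

ColIndep : ∀ {r c} → Matrix r c → Set
ColIndep {r} {c} X =
  (v : Fin c → ℚ) → (∀ i → Σℚ c (λ j → X i j * v j) ≡ 0ℚ) → ∀ j → v j ≡ 0ℚ

RowIndep : ∀ {r c} → Matrix r c → Set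
RowIndep {r} {c} X =
  (w : Fin r → ℚ) → (∀ j → Σℚ r (λ i → w i * X i j) ≡ 0ℚ) → ∀ i → w i ≡ 0ℚ

FullRank : ∀ {r c} → Matrix r c → Set
FullRank {r} {c} X with c ≤? r
... | Relation.Nullary.yes _ = ColIndep X
... | Relation.Nullary.no  _ = RowIndep X

-- submatrix T_{A,B} (finite sets given as duplicate-free lists)
Tsub : ∀ {k} (A B : List (Vec ℕ k)) → Matrix (length A) (length B)
Tsub A B i j = Tentry (lookup A i) (lookup B j)

fiberSize : ∀ {k} → List (Vec ℕ (suc k)) → Vec ℕ k → ℕ
fiberSize B e = length (filter (λ b → init b ≟ᵥ e) B)

-- Find-Cone-closed(B, m+1)   (dimension n = suc m)
findCone : ∀ m → List (Vec ℕ (suc m)) → List (Vec ℕ (suc m))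
findCone zero    B = applyUpTo (λ t → t ∷ []) (length B)
findCone (suc m) B =
  concat (applyUpTo (λ i → map (λ s → s ∷ʳ i) (findCone m (F (suc i)))) ℓ)
  where
    πB : List (Vec ℕ (suc m))
    πB = deduplicate _≟ᵥ_ (map init B)
    ℓ : ℕ
    ℓ = foldr (λ e r → fiberSize B e ⊔ r) 0 πB
    F : ℕ → List (Vec ℕ (suc m))
    F i = filter (λ e → i ≤? fiberSize B e) πB

-- Counting the fibres of the projection dropping the last coordinate shows |A| = |B|, so it suffices that
-- T_{A,B} v = 0 forces v = 0.  In dimension one this is a Vandermonde argument in the binomial basis:
-- C(b,k)(b - c) = (k+1) C(b,k+1) + (k - c) C(b,k) lets one strip off the point c.  In dimension n + 1,
-- T_{s∷ʳi, b} = T_{s, init b} · C(last b, i), so the i-th binomial moments of v along the fibres form a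
-- vector in the kernel of T_{S_(i+1), F_(i+1)} (by induction on i, fibres of size ≤ i are already zero), hence
-- vanish by induction on the dimension; all moments of a fibre vanishing forces v to vanish on it.
module Submission where

open import Defs
open import Data.Nat using (ℕ; suc; _≤_)
open import Data.Vec using (Vec)
open import Data.List using (List; [])
open import Data.List.Relation.Unary.All using (All)
open import Data.List.Relation.Unary.Unique.Propositional using (Unique)
open import Relation.Binary.PropositionalEquality using (_≢_)

open import Algebra.Bundles using (CommutativeMonoid)
import Algebra.Properties.Group as GroupProperties
open import Data.Bool using (true; false; if_then_else_)
open import Data.Nat as ℕ using (zero; _<_; _≤?_; _⊔_; s≤s; z≤n)
import Data.Nat.Properties as ℕP
open import Data.Nat.Combinatorics using (_C_; nC1≡n; nCk+nC[k+1]≡[n+1]C[k+1])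
open import Data.Nat.Induction using (<-rec)
open import Data.Integer using (+_)
import Data.Integer.Properties as ℤP
open import Data.Nat.Coprimality as Coprimality using (1-coprimeTo)
open import Data.Rational using (ℚ; 0ℚ; 1ℚ; _+_; _*_; _-_; _/_; mkℚ; ↥_; 1/_; ≢-nonZero)
import Data.Rational.Properties as ℚP
import Data.Rational.Solver as ℚSolver
import Data.Nat.Solver as ℕSolver
open import Data.Fin using (Fin; zero; suc)
open import Data.Vec as Vec using ([]; _∷_; _∷ʳ_; init; last; head)
open import Data.List using (_∷_; length; map; filter; deduplicate; applyUpTo; upTo; concat; foldr; lookup)
import Data.List.Properties as ListP
open import Data.List.Membership.Propositional using (_∈_)
open import Data.List.Membership.Propositional.Properties
  using (∈-map⁺; ∈-filter⁺; ∈-filter⁻; ∈-applyUpTo⁺; ∈-concat⁺′; ∈-lookup)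
open import Data.List.Relation.Unary.Any using (here; there; index)
open import Data.List.Relation.Unary.Any.Properties using (lookup-index; deduplicate⁺)
import Data.List.Relation.Unary.All as All
open import Data.List.Relation.Unary.AllPairs using (_∷_)
import Data.List.Relation.Unary.Unique.Propositional.Properties as UniqueP
import Data.List.Relation.Unary.Unique.DecPropositional.Properties as DecUniqueP
open import Data.Product using (_,_; proj₂)
open import Function using (_∘_)
open import Relation.Binary.Definitions using (DecidableEquality)
open import Relation.Binary.PropositionalEquality as ≡ using (_≡_; refl; sym; trans; cong; cong₂; module ≡-Reasoning)
open import Relation.Nullary using (¬_; yes; no; does; contradiction)
open import Relation.Unary using (Pred; Decidable)

module ListSum {c r} (M : CommutativeMonoid c r) where

  open CommutativeMonoid M
    renaming ( Carrier to R; _∙_ to _+ᴹ_; ε to 0#; ∙-cong to +-cong; identityˡ to +-identityˡ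
             ; refl to ≈-refl; sym to ≈-sym; trans to ≈-trans )
  open import Algebra.Solver.CommutativeMonoid M using (solve; _⊕_; _⊜_)
  open import Relation.Binary.Reasoning.Setoid setoid

  ∑ : {A : Set} → List A → (A → R) → R
  ∑ []       f = 0#
  ∑ (x ∷ xs) f = f x +ᴹ ∑ xs f

  syntax ∑ xs (λ x → e) = ∑[ x ∈ xs ] e

  ∑-cong : ∀ {A : Set} (xs : List A) {f g : A → R} → (∀ {x} → x ∈ xs → f x ≈ g x) → ∑ xs f ≈ ∑ xs g
  ∑-cong []       eq = ≈-refl
  ∑-cong (x ∷ xs) eq = +-cong (eq (here ≡.refl)) (∑-cong xs (eq ∘ there))

  ∑-zero : ∀ {A : Set} (xs : List A) {f : A → R} → (∀ {x} → x ∈ xs → f x ≈ 0#) → ∑ xs f ≈ 0#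
  ∑-zero []       eq = ≈-refl
  ∑-zero (x ∷ xs) eq = ≈-trans (+-cong (eq (here ≡.refl)) (∑-zero xs (eq ∘ there))) (+-identityˡ 0#)

  ∑-distrib-+ : ∀ {A : Set} (xs : List A) (f g : A → R) → ∑[ x ∈ xs ] (f x +ᴹ g x) ≈ ∑ xs f +ᴹ ∑ xs g
  ∑-distrib-+ []       f g = ≈-sym (+-identityˡ 0#)
  ∑-distrib-+ (x ∷ xs) f g = ≈-trans (+-cong ≈-refl (∑-distrib-+ xs f g))
    (solve 4 (λ a b c d → (a ⊕ b) ⊕ (c ⊕ d) ⊜ (a ⊕ c) ⊕ (b ⊕ d)) ≈-refl (f x) (g x) (∑ xs f) (∑ xs g))

  ∑-map : ∀ {A B : Set} (g : A → B) (xs : List A) (f : B → R) → ∑ (map g xs) f ≈ ∑[ x ∈ xs ] f (g x)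
  ∑-map g []       f = ≈-refl
  ∑-map g (x ∷ xs) f = +-cong ≈-refl (∑-map g xs f)

  ∑-swap : ∀ {A B : Set} (xs : List A) (ys : List B) (f : A → B → R) →
           ∑[ x ∈ xs ] ∑[ y ∈ ys ] f x y ≈ ∑[ y ∈ ys ] ∑[ x ∈ xs ] f x y
  ∑-swap []       ys f = ≈-sym (∑-zero ys (λ _ → ≈-refl))
  ∑-swap (x ∷ xs) ys f =
    ≈-trans (+-cong ≈-refl (∑-swap xs ys f)) (≈-sym (∑-distrib-+ ys (f x) (λ y → ∑[ x ∈ xs ] f x y)))

  ∑-filter : ∀ {A : Set} {p} {P : Pred A p} (P? : Decidable P) (xs : List A) (f : A → R) →
             ∑ (filter P? xs) f ≈ ∑[ x ∈ xs ] (if does (P? x) then f x else 0#)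
  ∑-filter P? []       f = ≈-refl
  ∑-filter P? (x ∷ xs) f with does (P? x)
  ... | true  = +-cong ≈-refl (∑-filter P? xs f)
  ... | false = ≈-trans (∑-filter P? xs f) (≈-sym (+-identityˡ _))

  ∑-filter-support : ∀ {A : Set} {p} {P : Pred A p} (P? : Decidable P) (xs : List A) (f : A → R) →
                     (∀ {x} → x ∈ xs → ¬ P x → f x ≈ 0#) → ∑ (filter P? xs) f ≈ ∑ xs f
  ∑-filter-support P? []       f off = ≈-refl
  ∑-filter-support P? (x ∷ xs) f off with P? x
  ... | yes _  = +-cong ≈-refl (∑-filter-support P? xs f (off ∘ there))
  ... | no ¬px = ≈-trans (∑-filter-support P? xs f (off ∘ there))
                   (≈-sym (≈-trans (+-cong (off (here ≡.refl) ¬px) ≈-refl) (+-identityˡ _)))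

  ∑-indicator : ∀ {E : Set} (_≟_ : DecidableEquality E) {es : List E} → Unique es →
                ∀ {e₀} → e₀ ∈ es → ∀ r → ∑[ e ∈ es ] (if does (e₀ ≟ e) then r else 0#) ≈ r
  ∑-indicator _≟_ {e ∷ es} (e∉ ∷ uniq) (here ≡.refl) r with e ≟ e
  ... | no e≢e = contradiction ≡.refl e≢e
  ... | yes _  = ≈-trans (+-cong ≈-refl (∑-zero es off)) (identityʳ r)
    where
      off : ∀ {e′} → e′ ∈ es → (if does (e ≟ e′) then r else 0#) ≈ 0#
      off {e′} e′∈ with e ≟ e′
      ... | yes e≡e′ = contradiction e≡e′ (All.lookup e∉ e′∈)
      ... | no _     = ≈-refl
  ∑-indicator _≟_ {e ∷ es} (e∉ ∷ uniq) {e₀} (there e₀∈) r with e₀ ≟ e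
  ... | yes e₀≡e = contradiction (≡.sym e₀≡e) (All.lookup e∉ e₀∈)
  ... | no _     = ≈-trans (+-identityˡ _) (∑-indicator _≟_ uniq e₀∈ r)

  ∑-fibres : ∀ {A E : Set} (π : A → E) (_≟_ : DecidableEquality E) {es : List E} → Unique es →
             (xs : List A) → (∀ {x} → x ∈ xs → π x ∈ es) → (f : A → R) →
             ∑ xs f ≈ ∑[ e ∈ es ] ∑ (filter (λ x → π x ≟ e) xs) f
  ∑-fibres π _≟_ {es} uniq xs covered f = begin
    ∑ xs f
      ≈⟨ ∑-cong xs (λ {x} x∈ → ≈-sym (∑-indicator _≟_ uniq (covered x∈) (f x))) ⟩
    ∑[ x ∈ xs ] ∑[ e ∈ es ] (if does (π x ≟ e) then f x else 0#)
      ≈⟨ ∑-swap xs es _ ⟩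
    ∑[ e ∈ es ] ∑[ x ∈ xs ] (if does (π x ≟ e) then f x else 0#)
      ≈⟨ ∑-cong es (λ {e} _ → ≈-sym (∑-filter (λ x → π x ≟ e) xs f)) ⟩
    ∑[ e ∈ es ] ∑ (filter (λ x → π x ≟ e) xs) f ∎

-- The local definitions of findCone, so that findCone (suc m) B unfolds to them definitionally.
πB : ∀ {k} → List (Vec ℕ (suc k)) → List (Vec ℕ k)
πB B = deduplicate _≟ᵥ_ (map init B)

ℓ : ∀ {k} → List (Vec ℕ (suc k)) → ℕ
ℓ B = foldr (λ e r → fiberSize B e ⊔ r) 0 (πB B)

F : ∀ {k} → List (Vec ℕ (suc k)) → ℕ → List (Vec ℕ k)
F B i = filter (λ e → i ≤? fiberSize B e) (πB B)

fibre : ∀ {k} → List (Vec ℕ (suc k)) → Vec ℕ k → List (Vec ℕ (suc k))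
fibre B e = filter (λ b → init b ≟ᵥ e) B

πB-unique : ∀ {k} (B : List (Vec ℕ (suc k))) → Unique (πB B)
πB-unique B = DecUniqueP.deduplicate-! _≟ᵥ_ (map init B)

init∈πB : ∀ {k} {B : List (Vec ℕ (suc k))} {b} → b ∈ B → init b ∈ πB B
init∈πB b∈ = deduplicate⁺ _≟ᵥ_ (λ eq p → trans p (sym eq)) (∈-map⁺ init b∈)

≤-foldr-⊔ : ∀ {A : Set} (f : A → ℕ) {xs : List A} {x} → x ∈ xs → f x ≤ foldr (λ y r → f y ⊔ r) 0 xs
≤-foldr-⊔ f {y ∷ _} (here refl) = ℕP.m≤m⊔n (f y) _
≤-foldr-⊔ f {y ∷ _} (there x∈) = ℕP.≤-trans (≤-foldr-⊔ f x∈) (ℕP.m≤n⊔m (f y) _)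

fiberSize≤ℓ : ∀ {k} {B : List (Vec ℕ (suc k))} {e} → e ∈ πB B → fiberSize B e ≤ ℓ B
fiberSize≤ℓ {B = B} = ≤-foldr-⊔ (fiberSize B)

∈-findCone-suc : ∀ {m} {B : List (Vec ℕ (suc (suc m)))} {i s} →
                 i < ℓ B → s ∈ findCone m (F B (suc i)) → s ∷ʳ i ∈ findCone (suc m) B
∈-findCone-suc {m} {B} i<ℓ s∈ =
  ∈-concat⁺′ (∈-map⁺ (_∷ʳ _) s∈) (∈-applyUpTo⁺ (λ i → map (_∷ʳ i) (findCone m (F B (suc i)))) i<ℓ)

module Counting where

  open ListSum ℕP.+-0-commutativeMonoid

  length≡∑1 : ∀ {A : Set} (xs : List A) → length xs ≡ ∑[ x ∈ xs ] 1
  length≡∑1 []       = refl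
  length≡∑1 (x ∷ xs) = cong suc (length≡∑1 xs)

  length-filter : ∀ {A : Set} {p} {P : Pred A p} (P? : Decidable P) (xs : List A) →
                  length (filter P? xs) ≡ ∑[ x ∈ xs ] (if does (P? x) then 1 else 0)
  length-filter P? xs = trans (length≡∑1 (filter P? xs)) (∑-filter P? xs (λ _ → 1))

  length-concat : ∀ {A : Set} (xss : List (List A)) → length (concat xss) ≡ ∑ xss length
  length-concat []         = refl
  length-concat (xs ∷ xss) = trans (ListP.length-++ xs) (cong (length xs ℕ.+_) (length-concat xss))

  ∑-upTo-suc : ∀ n (f : ℕ → ℕ) → ∑ (upTo (suc n)) f ≡ f 0 ℕ.+ ∑[ i ∈ upTo n ] f (suc i)
  ∑-upTo-suc n f = cong (f 0 ℕ.+_) (trans (cong (λ is → ∑ is f) (sym (ListP.map-upTo suc n))) (∑-map suc (upTo n) f))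

  ∑-upTo-indicator : ∀ n x → x ≤ n → ∑[ i ∈ upTo n ] (if does (suc i ≤? x) then 1 else 0) ≡ x
  ∑-upTo-indicator zero    zero    _         = refl
  ∑-upTo-indicator (suc n) zero    _         = ∑-zero (upTo (suc n)) (λ _ → refl)
  ∑-upTo-indicator (suc n) (suc x) (s≤s x≤n) =
    trans (∑-upTo-suc n (λ i → if does (suc i ≤? suc x) then 1 else 0)) (cong suc (∑-upTo-indicator n x x≤n))

  ∑-fiberSize : ∀ {k} (B : List (Vec ℕ (suc k))) → ∑ (πB B) (fiberSize B) ≡ length B
  ∑-fiberSize B = begin
    ∑[ e ∈ πB B ] length (fibre B e)   ≡⟨ ∑-cong (πB B) (λ {e} _ → length≡∑1 (fibre B e)) ⟩
    ∑[ e ∈ πB B ] ∑[ b ∈ fibre B e ] 1 ≡⟨ sym (∑-fibres init _≟ᵥ_ (πB-unique B) B init∈πB (λ _ → 1)) ⟩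
    ∑[ b ∈ B ] 1                       ≡⟨ sym (length≡∑1 B) ⟩
    length B                           ∎
    where open ≡-Reasoning

  length-findCone : ∀ m (B : List (Vec ℕ (suc m))) → length (findCone m B) ≡ length B
  length-findCone zero    B = ListP.length-applyUpTo (_∷ []) (length B)
  length-findCone (suc m) B = begin
    length (findCone (suc m) B)
      ≡⟨ length-concat (applyUpTo layer (ℓ B)) ⟩
    ∑ (applyUpTo layer (ℓ B)) length
      ≡⟨ cong (λ ls → ∑ ls length) (sym (ListP.map-upTo layer (ℓ B))) ⟩
    ∑ (map layer (upTo (ℓ B))) length
      ≡⟨ ∑-map layer (upTo (ℓ B)) length ⟩
    ∑[ i ∈ upTo (ℓ B) ] length (layer i)
      ≡⟨ ∑-cong (upTo (ℓ B)) (λ {i} _ → layer-length i) ⟩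
    ∑[ i ∈ upTo (ℓ B) ] ∑[ e ∈ πB B ] (if does (suc i ≤? fiberSize B e) then 1 else 0)
      ≡⟨ ∑-swap (upTo (ℓ B)) (πB B) _ ⟩
    ∑[ e ∈ πB B ] ∑[ i ∈ upTo (ℓ B) ] (if does (suc i ≤? fiberSize B e) then 1 else 0)
      ≡⟨ ∑-cong (πB B) (λ {e} e∈ → ∑-upTo-indicator (ℓ B) (fiberSize B e) (fiberSize≤ℓ e∈)) ⟩
    ∑ (πB B) (fiberSize B)
      ≡⟨ ∑-fiberSize B ⟩
    length B ∎
    where
      open ≡-Reasoning
      layer : ℕ → List (Vec ℕ (suc (suc m)))
      layer i = map (_∷ʳ i) (findCone m (F B (suc i)))
      layer-length : ∀ i → length (layer i) ≡ ∑[ e ∈ πB B ] (if does (suc i ≤? fiberSize B e) then 1 else 0)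
      layer-length i = trans (ListP.length-map (_∷ʳ i) (findCone m (F B (suc i))))
        (trans (length-findCone m (F B (suc i))) (length-filter (λ e → suc i ≤? fiberSize B e) (πB B)))

open Counting using (length-findCone)
open ListSum ℚP.+-0-commutativeMonoid

∑-*ˡ : ∀ {A : Set} (xs : List A) c (f : A → ℚ) → ∑[ x ∈ xs ] (c * f x) ≡ c * ∑ xs f
∑-*ˡ []       c f = sym (ℚP.*-zeroʳ c)
∑-*ˡ (x ∷ xs) c f = trans (cong (_+_ (c * f x)) (∑-*ˡ xs c f)) (sym (ℚP.*-distribˡ-+ c (f x) (∑ xs f)))

p*q≡0⇒p≡0 : ∀ p q → p * q ≡ 0ℚ → q ≢ 0ℚ → p ≡ 0ℚ
p*q≡0⇒p≡0 p q pq≡0 q≢0 = begin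
  p                ≡⟨ sym (ℚP.*-identityʳ p) ⟩
  p * 1ℚ           ≡⟨ cong (p *_) (sym (ℚP.*-inverseʳ q)) ⟩
  p * (q * 1/ q)   ≡⟨ sym (ℚP.*-assoc p q (1/ q)) ⟩
  (p * q) * 1/ q   ≡⟨ cong (_* 1/ q) pq≡0 ⟩
  0ℚ * 1/ q        ≡⟨ ℚP.*-zeroˡ (1/ q) ⟩
  0ℚ               ∎
  where
    open ≡-Reasoning
    instance _ = ≢-nonZero q≢0

toℚ : ℕ → ℚ
toℚ n = + n / 1

toℚ≡mkℚ : ∀ n → toℚ n ≡ mkℚ (+ n) 0 (Coprimality.sym (1-coprimeTo n))
toℚ≡mkℚ n = ℚP.normalize-coprime (Coprimality.sym (1-coprimeTo n))

toℚ-+ : ∀ a b → toℚ (a ℕ.+ b) ≡ toℚ a + toℚ b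
toℚ-+ a b rewrite toℚ≡mkℚ a | toℚ≡mkℚ b =
  cong (_/ 1) (sym (cong₂ Data.Integer._+_ (ℤP.*-identityʳ (+ a)) (ℤP.*-identityʳ (+ b))))

toℚ-* : ∀ a b → toℚ (a ℕ.* b) ≡ toℚ a * toℚ b
toℚ-* a b rewrite toℚ≡mkℚ a | toℚ≡mkℚ b = cong (_/ 1) (ℤP.pos-* a b)

toℚ-injective : ∀ {a b} → toℚ a ≡ toℚ b → a ≡ b
toℚ-injective {a} {b} eq = ℤP.+-injective (cong ↥_ (trans (sym (toℚ≡mkℚ a)) (trans eq (toℚ≡mkℚ b))))

toℚ-≢⇒-≢0 : ∀ {a b} → a ≢ b → toℚ a - toℚ b ≢ 0ℚ
toℚ-≢⇒-≢0 {a} {b} a≢b eq = a≢b (toℚ-injective (GroupProperties.x∙y⁻¹≈ε⇒x≈y ℚP.+-0-group (toℚ a) (toℚ b) eq))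

nCk*n≡[k+1]*nC[k+1]+k*nCk : ∀ n k → (n C k) ℕ.* n ≡ suc k ℕ.* (n C suc k) ℕ.+ k ℕ.* (n C k)
nCk*n≡[k+1]*nC[k+1]+k*nCk n zero =
  trans (ℕP.*-identityˡ n) (trans (sym (nC1≡n n)) (sym (trans (ℕP.+-identityʳ _) (ℕP.+-identityʳ _))))
nCk*n≡[k+1]*nC[k+1]+k*nCk zero (suc k) = sym (cong₂ ℕ._+_ (ℕP.*-zeroʳ (suc (suc k))) (ℕP.*-zeroʳ (suc k)))
nCk*n≡[k+1]*nC[k+1]+k*nCk (suc n) (suc k) = begin
  (suc n C suc k) ℕ.* suc n
    ≡⟨ cong (ℕ._* suc n) (sym (nCk+nC[k+1]≡[n+1]C[k+1] n k)) ⟩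
  (Y ℕ.+ X) ℕ.* suc n
    ≡⟨ solve 3 (λ Y X n → (Y :+ X) :* (con 1 :+ n) := Y :* n :+ X :* n :+ Y :+ X) refl Y X n ⟩
  Y ℕ.* n ℕ.+ X ℕ.* n ℕ.+ Y ℕ.+ X
    ≡⟨ cong₂ (λ p q → p ℕ.+ q ℕ.+ Y ℕ.+ X) (nCk*n≡[k+1]*nC[k+1]+k*nCk n k) (nCk*n≡[k+1]*nC[k+1]+k*nCk n (suc k)) ⟩
  (suc k ℕ.* X ℕ.+ k ℕ.* Y) ℕ.+ (suc (suc k) ℕ.* Z ℕ.+ suc k ℕ.* X) ℕ.+ Y ℕ.+ X
    ≡⟨ solve 4 (λ k X Y Z → ((con 1 :+ k) :* X :+ k :* Y) :+ ((con 2 :+ k) :* Z :+ (con 1 :+ k) :* X) :+ Y :+ X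
                            := (con 2 :+ k) :* (X :+ Z) :+ (con 1 :+ k) :* (Y :+ X)) refl k X Y Z ⟩
  suc (suc k) ℕ.* (X ℕ.+ Z) ℕ.+ suc k ℕ.* (Y ℕ.+ X)
    ≡⟨ cong₂ (λ p q → suc (suc k) ℕ.* p ℕ.+ suc k ℕ.* q)
         (nCk+nC[k+1]≡[n+1]C[k+1] n (suc k)) (nCk+nC[k+1]≡[n+1]C[k+1] n k) ⟩
  suc (suc k) ℕ.* (suc n C suc (suc k)) ℕ.+ suc k ℕ.* (suc n C suc k) ∎
  where
    open ≡-Reasoning
    open ℕSolver.+-*-Solver
    Y = n C k
    X = n C suc k
    Z = n C suc (suc k)

open ℚSolver.+-*-Solver

binomial-shift : ∀ n k c →
  toℚ (n C k) * (toℚ n - toℚ c) ≡ toℚ (suc k) * toℚ (n C suc k) + (toℚ k - toℚ c) * toℚ (n C k)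
binomial-shift n k c = begin
  toℚ (n C k) * (toℚ n - toℚ c)
    ≡⟨ solve 3 (λ x y z → x :* (y :- z) := x :* y :- z :* x) refl (toℚ (n C k)) (toℚ n) (toℚ c) ⟩
  toℚ (n C k) * toℚ n - toℚ c * toℚ (n C k)
    ≡⟨ cong (_- toℚ c * toℚ (n C k)) absorption ⟩
  (toℚ (suc k) * toℚ (n C suc k) + toℚ k * toℚ (n C k)) - toℚ c * toℚ (n C k)
    ≡⟨ solve 5 (λ p q r s t → (p :* q :+ r :* s) :- t :* s := p :* q :+ (r :- t) :* s) refl
         (toℚ (suc k)) (toℚ (n C suc k)) (toℚ k) (toℚ (n C k)) (toℚ c) ⟩
  toℚ (suc k) * toℚ (n C suc k) + (toℚ k - toℚ c) * toℚ (n C k) ∎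
  where
    open ≡-Reasoning
    absorption : toℚ (n C k) * toℚ n ≡ toℚ (suc k) * toℚ (n C suc k) + toℚ k * toℚ (n C k)
    absorption = begin
      toℚ (n C k) * toℚ n
        ≡⟨ sym (toℚ-* (n C k) n) ⟩
      toℚ ((n C k) ℕ.* n)
        ≡⟨ cong toℚ (nCk*n≡[k+1]*nC[k+1]+k*nCk n k) ⟩
      toℚ (suc k ℕ.* (n C suc k) ℕ.+ k ℕ.* (n C k))
        ≡⟨ toℚ-+ (suc k ℕ.* (n C suc k)) (k ℕ.* (n C k)) ⟩
      toℚ (suc k ℕ.* (n C suc k)) + toℚ (k ℕ.* (n C k))
        ≡⟨ cong₂ _+_ (toℚ-* (suc k) (n C suc k)) (toℚ-* k (n C k)) ⟩
      toℚ (suc k) * toℚ (n C suc k) + toℚ k * toℚ (n C k) ∎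

binomialMoment : ∀ {A : Set} → (A → ℕ) → List A → (A → ℚ) → ℕ → ℚ
binomialMoment g xs u k = ∑[ x ∈ xs ] (toℚ (g x C k) * u x)

binomialMoment-shift : ∀ {A : Set} (g : A → ℕ) (xs : List A) (u : A → ℚ) c k →
  binomialMoment g xs (λ x → u x * (toℚ (g x) - toℚ c)) k
    ≡ toℚ (suc k) * binomialMoment g xs u (suc k) + (toℚ k - toℚ c) * binomialMoment g xs u k
binomialMoment-shift g xs u c k = begin
  ∑[ x ∈ xs ] (toℚ (g x C k) * (u x * (toℚ (g x) - toℚ c)))
    ≡⟨ ∑-cong xs (λ {x} _ → termwise x) ⟩
  ∑[ x ∈ xs ] (toℚ (suc k) * (toℚ (g x C suc k) * u x) + (toℚ k - toℚ c) * (toℚ (g x C k) * u x))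
    ≡⟨ ∑-distrib-+ xs _ _ ⟩
  ∑[ x ∈ xs ] (toℚ (suc k) * (toℚ (g x C suc k) * u x)) + ∑[ x ∈ xs ] ((toℚ k - toℚ c) * (toℚ (g x C k) * u x))
    ≡⟨ cong₂ _+_ (∑-*ˡ xs (toℚ (suc k)) _) (∑-*ˡ xs (toℚ k - toℚ c) _) ⟩
  toℚ (suc k) * binomialMoment g xs u (suc k) + (toℚ k - toℚ c) * binomialMoment g xs u k ∎
  where
    open ≡-Reasoning
    termwise : ∀ x → toℚ (g x C k) * (u x * (toℚ (g x) - toℚ c))
                     ≡ toℚ (suc k) * (toℚ (g x C suc k) * u x) + (toℚ k - toℚ c) * (toℚ (g x C k) * u x)
    termwise x =
      trans (solve 3 (λ p q r → p :* (q :* r) := q :* (p :* r)) refl (toℚ (g x C k)) (u x) (toℚ (g x) - toℚ c))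
      (trans (cong (u x *_) (binomial-shift (g x) k c))
        (solve 5 (λ U p q r s → U :* (p :* q :+ r :* s) := p :* (q :* U) :+ r :* (s :* U)) refl
          (u x) (toℚ (suc k)) (toℚ (g x C suc k)) (toℚ k - toℚ c) (toℚ (g x C k))))

-- Multiplying u by (g x - g x₀) kills the x₀ term and, by binomial-shift, keeps the lower moments zero.
binomialMoments≡0⇒≡0 : ∀ {A : Set} (g : A → ℕ) (xs : List A) → Unique xs →
  (∀ {x y} → x ∈ xs → y ∈ xs → g x ≡ g y → x ≡ y) → (u : A → ℚ) →
  (∀ k → k < length xs → binomialMoment g xs u k ≡ 0ℚ) → ∀ {x} → x ∈ xs → u x ≡ 0ℚ
binomialMoments≡0⇒≡0 g [] _ _ u _ ()
binomialMoments≡0⇒≡0 {A} g (x₀ ∷ xs) (x₀∉ ∷ uniq) inj u moments≡0 = vanishes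
  where
    open ≡-Reasoning
    d : A → ℚ
    d x = toℚ (g x) - toℚ (g x₀)
    head-term≡0 : ∀ k → toℚ (g x₀ C k) * (u x₀ * d x₀) ≡ 0ℚ
    head-term≡0 k = trans (cong (λ z → toℚ (g x₀ C k) * (u x₀ * z)) (ℚP.+-inverseʳ (toℚ (g x₀))))
      (trans (cong (toℚ (g x₀ C k) *_) (ℚP.*-zeroʳ (u x₀))) (ℚP.*-zeroʳ (toℚ (g x₀ C k))))
    shifted≡0 : ∀ k → k < length xs → binomialMoment g xs (λ x → u x * d x) k ≡ 0ℚ
    shifted≡0 k k< = begin
      binomialMoment g xs (λ x → u x * d x) k
        ≡⟨ sym (trans (cong (_+ shifted) (head-term≡0 k)) (ℚP.+-identityˡ shifted)) ⟩
      binomialMoment g (x₀ ∷ xs) (λ x → u x * d x) k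
        ≡⟨ binomialMoment-shift g (x₀ ∷ xs) u (g x₀) k ⟩
      toℚ (suc k) * binomialMoment g (x₀ ∷ xs) u (suc k) + (toℚ k - toℚ (g x₀)) * binomialMoment g (x₀ ∷ xs) u k
        ≡⟨ cong₂ (λ p q → toℚ (suc k) * p + (toℚ k - toℚ (g x₀)) * q)
             (moments≡0 (suc k) (s≤s k<)) (moments≡0 k (ℕP.m<n⇒m<1+n k<)) ⟩
      toℚ (suc k) * 0ℚ + (toℚ k - toℚ (g x₀)) * 0ℚ
        ≡⟨ cong₂ _+_ (ℚP.*-zeroʳ (toℚ (suc k))) (ℚP.*-zeroʳ (toℚ k - toℚ (g x₀))) ⟩
      0ℚ ∎
      where shifted = binomialMoment g xs (λ x → u x * d x) k
    tail≡0 : ∀ {x} → x ∈ xs → u x ≡ 0ℚ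
    tail≡0 {x} x∈ = p*q≡0⇒p≡0 (u x) (d x)
      (binomialMoments≡0⇒≡0 g xs uniq (λ p q → inj (there p) (there q)) (λ x → u x * d x) shifted≡0 x∈)
      (toℚ-≢⇒-≢0 (λ gx≡gx₀ → All.lookup x₀∉ x∈ (sym (inj (there x∈) (here refl) gx≡gx₀))))
    head≡0 : u x₀ ≡ 0ℚ
    head≡0 = begin
      u x₀                              ≡⟨ sym (ℚP.+-identityʳ (u x₀)) ⟩
      u x₀ + 0ℚ                         ≡⟨ cong₂ _+_ (sym (ℚP.*-identityˡ (u x₀)))
                                                     (sym (∑-zero xs (λ x∈ → trans (ℚP.*-identityˡ _) (tail≡0 x∈)))) ⟩
      binomialMoment g (x₀ ∷ xs) u 0    ≡⟨ moments≡0 0 (s≤s z≤n) ⟩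
      0ℚ                                ∎
    vanishes : ∀ {x} → x ∈ x₀ ∷ xs → u x ≡ 0ℚ
    vanishes (here refl) = head≡0
    vanishes (there x∈)  = tail≡0 x∈

init-∷ʳ-last : ∀ {k} (b : Vec ℕ (suc k)) → b ≡ init b ∷ʳ last b
init-∷ʳ-last b = proj₂ (proj₂ (Vec.initLast b))

binomVec-∷ʳ : ∀ {k} (e s : Vec ℕ k) n i → binomVec (e ∷ʳ n) (s ∷ʳ i) ≡ binomVec e s ℕ.* (n C i)
binomVec-∷ʳ []      []      n i = trans (ℕP.*-identityʳ (n C i)) (sym (ℕP.*-identityˡ (n C i)))
binomVec-∷ʳ (x ∷ e) (y ∷ s) n i =
  trans (cong ((x C y) ℕ.*_) (binomVec-∷ʳ e s n i)) (sym (ℕP.*-assoc (x C y) _ (n C i)))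

Tentry-∷ʳ : ∀ {k} (s : Vec ℕ k) i (b : Vec ℕ (suc k)) → Tentry (s ∷ʳ i) b ≡ Tentry s (init b) * toℚ (last b C i)
Tentry-∷ʳ s i b = trans (cong (Tentry (s ∷ʳ i)) (init-∷ʳ-last b))
  (trans (cong toℚ (binomVec-∷ʳ (init b) s (last b) i)) (toℚ-* (binomVec (init b) s) (last b C i)))

fibreMoment : ∀ {k} → List (Vec ℕ (suc k)) → (Vec ℕ (suc k) → ℚ) → ℕ → Vec ℕ k → ℚ
fibreMoment B v i e = binomialMoment last (fibre B e) v i

∑-Tentry-∷ʳ : ∀ {k} (B : List (Vec ℕ (suc k))) (v : Vec ℕ (suc k) → ℚ) s i →
  ∑[ b ∈ B ] (Tentry (s ∷ʳ i) b * v b) ≡ ∑[ e ∈ πB B ] (Tentry s e * fibreMoment B v i e)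
∑-Tentry-∷ʳ B v s i = begin
  ∑[ b ∈ B ] (Tentry (s ∷ʳ i) b * v b)
    ≡⟨ ∑-fibres init _≟ᵥ_ (πB-unique B) B init∈πB _ ⟩
  ∑[ e ∈ πB B ] ∑[ b ∈ fibre B e ] (Tentry (s ∷ʳ i) b * v b)
    ≡⟨ ∑-cong (πB B) (λ {e} _ → trans (∑-cong (fibre B e) split) (∑-*ˡ (fibre B e) (Tentry s e) _)) ⟩
  ∑[ e ∈ πB B ] (Tentry s e * fibreMoment B v i e) ∎
  where
    open ≡-Reasoning
    split : ∀ {e b} → b ∈ fibre B e → Tentry (s ∷ʳ i) b * v b ≡ Tentry s e * (toℚ (last b C i) * v b)
    split {e} {b} b∈ with ∈-filter⁻ (λ b → init b ≟ᵥ e) {xs = B} b∈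
    ... | _ , refl = trans (cong (_* v b) (Tentry-∷ʳ s i b))
                           (ℚP.*-assoc (Tentry s (init b)) (toℚ (last b C i)) (v b))

fibre-vanishes : ∀ {k} {B : List (Vec ℕ (suc k))} → Unique B → ∀ {v e} →
  (∀ j → j < fiberSize B e → fibreMoment B v j e ≡ 0ℚ) → ∀ {b} → b ∈ fibre B e → v b ≡ 0ℚ
fibre-vanishes {B = B} uniq {v} {e} =
  binomialMoments≡0⇒≡0 last (fibre B e) (UniqueP.filter⁺ (λ b → init b ≟ᵥ e) uniq) last-injective v
  where
    last-injective : ∀ {x y} → x ∈ fibre B e → y ∈ fibre B e → last x ≡ last y → x ≡ y
    last-injective {x} {y} x∈ y∈ lastx≡lasty
      with ∈-filter⁻ (λ b → init b ≟ᵥ e) {xs = B} x∈ | ∈-filter⁻ (λ b → init b ≟ᵥ e) {xs = B} y∈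
    ... | _ , initx≡e | _ , inity≡e = begin
      x                  ≡⟨ init-∷ʳ-last x ⟩
      init x ∷ʳ last x   ≡⟨ cong₂ _∷ʳ_ (trans initx≡e (sym inity≡e)) lastx≡lasty ⟩
      init y ∷ʳ last y   ≡⟨ sym (init-∷ʳ-last y) ⟩
      y                  ∎
      where open ≡-Reasoning

InKernel : ∀ {k} → List (Vec ℕ k) → List (Vec ℕ k) → (Vec ℕ k → ℚ) → Set
InKernel A B v = ∀ {a} → a ∈ A → ∑[ b ∈ B ] (Tentry a b * v b) ≡ 0ℚ

KernelTrivial : ℕ → Set
KernelTrivial m = ∀ (B : List (Vec ℕ (suc m))) → Unique B →
  ∀ v → InKernel (findCone m B) B v → ∀ {b} → b ∈ B → v b ≡ 0ℚ

kernelTrivial-zero : KernelTrivial 0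
kernelTrivial-zero B uniq v v∈ker =
  binomialMoments≡0⇒≡0 head B uniq (λ _ _ → head-injective) v
    (λ k k< → trans (∑-cong B (λ {x} _ → Tentry-singleton k x)) (v∈ker (∈-applyUpTo⁺ (_∷ []) k<)))
  where
    head-injective : ∀ {x y : Vec ℕ 1} → head x ≡ head y → x ≡ y
    head-injective {_ ∷ []} {_ ∷ []} refl = refl
    Tentry-singleton : ∀ k x → toℚ (head x C k) * v x ≡ Tentry (k ∷ []) x * v x
    Tentry-singleton k (y ∷ []) = cong (λ n → toℚ n * v (y ∷ [])) (sym (ℕP.*-identityʳ (y C k)))

FibreMomentsVanish : ∀ {k} → List (Vec ℕ (suc k)) → (Vec ℕ (suc k) → ℚ) → ℕ → Set
FibreMomentsVanish B v i = ∀ {e} → e ∈ πB B → i < fiberSize B e → fibreMoment B v i e ≡ 0ℚ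

fibreMoments-vanish-step : ∀ {m} → KernelTrivial m → ∀ {B : List (Vec ℕ (suc (suc m)))} → Unique B →
  ∀ {v} → InKernel (findCone (suc m) B) B v →
  ∀ i → (∀ {j} → j < i → FibreMomentsVanish B v j) → FibreMomentsVanish B v i
fibreMoments-vanish-step {m} ih {B} uniq {v} v∈ker i lower {e} e∈πB i<fib =
  ih (F B (suc i)) (UniqueP.filter⁺ (λ e → suc i ≤? fiberSize B e) (πB-unique B))
     (fibreMoment B v i) restricted∈ker (∈-filter⁺ (λ e → suc i ≤? fiberSize B e) e∈πB i<fib)
  where
    open ≡-Reasoning
    thin-fibre-vanishes : ∀ {e′} → e′ ∈ πB B → ¬ (suc i ≤ fiberSize B e′) → fibreMoment B v i e′ ≡ 0ℚ
    thin-fibre-vanishes {e′} e′∈ fib≤i =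
      ∑-zero (fibre B e′) (λ {b} b∈ → trans (cong (toℚ (last b C i) *_) (v≡0 b∈)) (ℚP.*-zeroʳ (toℚ (last b C i))))
      where
        v≡0 : ∀ {b} → b ∈ fibre B e′ → v b ≡ 0ℚ
        v≡0 = fibre-vanishes uniq (λ j j<fib → lower (ℕP.<-≤-trans j<fib (ℕP.≮⇒≥ fib≤i)) e′∈ j<fib)
    restricted∈ker : InKernel (findCone m (F B (suc i))) (F B (suc i)) (fibreMoment B v i)
    restricted∈ker {s} s∈ = begin
      ∑[ e ∈ F B (suc i) ] (Tentry s e * fibreMoment B v i e)
        ≡⟨ ∑-filter-support (λ e → suc i ≤? fiberSize B e) (πB B) _
             (λ {e} e∈ fib≤i → trans (cong (Tentry s e *_) (thin-fibre-vanishes e∈ fib≤i)) (ℚP.*-zeroʳ (Tentry s e))) ⟩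
      ∑[ e ∈ πB B ] (Tentry s e * fibreMoment B v i e)
        ≡⟨ sym (∑-Tentry-∷ʳ B v s i) ⟩
      ∑[ b ∈ B ] (Tentry (s ∷ʳ i) b * v b)
        ≡⟨ v∈ker (∈-findCone-suc {B = B} (ℕP.<-≤-trans i<fib (fiberSize≤ℓ e∈πB)) s∈) ⟩
      0ℚ ∎

kernelTrivial-suc : ∀ {m} → KernelTrivial m → KernelTrivial (suc m)
kernelTrivial-suc ih B uniq v v∈ker {b} b∈B =
  fibre-vanishes uniq (λ j j<fib → allMoments j (init∈πB b∈B) j<fib)
    (∈-filter⁺ (λ x → init x ≟ᵥ init b) b∈B refl)
  where
    allMoments : ∀ i → FibreMomentsVanish B v i
    allMoments = <-rec (FibreMomentsVanish B v) (fibreMoments-vanish-step ih uniq v∈ker)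

findCone-kernelTrivial : ∀ m → KernelTrivial m
findCone-kernelTrivial zero    = kernelTrivial-zero
findCone-kernelTrivial (suc m) = kernelTrivial-suc (findCone-kernelTrivial m)

module _ {A : Set} (_≟_ : DecidableEquality A) where

  onPoints : (xs : List A) → (Fin (length xs) → ℚ) → A → ℚ
  onPoints []       v x = 0ℚ
  onPoints (y ∷ ys) v x = if does (y ≟ x) then v zero else onPoints ys (v ∘ suc) x

  onPoints-∷-≢ : ∀ y ys v {x} → y ≢ x → onPoints (y ∷ ys) v x ≡ onPoints ys (v ∘ suc) x
  onPoints-∷-≢ y ys v {x} y≢x with y ≟ x
  ... | yes y≡x = contradiction y≡x y≢x
  ... | no _    = refl

  onPoints-lookup : ∀ {xs} → Unique xs → ∀ v j → onPoints xs v (lookup xs j) ≡ v j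
  onPoints-lookup {y ∷ ys} _ v zero with y ≟ y
  ... | yes _   = refl
  ... | no y≢y  = contradiction refl y≢y
  onPoints-lookup {y ∷ ys} (y∉ ∷ uniq) v (suc j) =
    trans (onPoints-∷-≢ y ys v (All.lookup y∉ (∈-lookup j))) (onPoints-lookup uniq (v ∘ suc) j)

  Σℚ-lookup : ∀ {xs} → Unique xs → (f : A → ℚ) (v : Fin (length xs) → ℚ) →
              Σℚ (length xs) (λ j → f (lookup xs j) * v j) ≡ ∑[ x ∈ xs ] (f x * onPoints xs v x)
  Σℚ-lookup {[]}     _            f v = refl
  Σℚ-lookup {y ∷ ys} (y∉ ∷ uniq) f v = cong₂ _+_
    (cong (f y *_) (sym (onPoints-lookup (y∉ ∷ uniq) v zero)))
    (trans (Σℚ-lookup uniq f (v ∘ suc))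
      (∑-cong ys (λ x∈ → cong (f _ *_) (sym (onPoints-∷-≢ y ys v (All.lookup y∉ x∈))))))

Tsub-ColIndep : ∀ {k} (A B : List (Vec ℕ k)) → Unique B →
  (∀ v → InKernel A B v → ∀ {b} → b ∈ B → v b ≡ 0ℚ) → ColIndep (Tsub A B)
Tsub-ColIndep A B uniq kernelTrivial v Tv≡0 j = begin
  v j                                ≡⟨ sym (onPoints-lookup _≟ᵥ_ uniq v j) ⟩
  onPoints _≟ᵥ_ B v (lookup B j)     ≡⟨ kernelTrivial (onPoints _≟ᵥ_ B v) v∈ker (∈-lookup j) ⟩
  0ℚ                                 ∎
  where
    open ≡-Reasoning
    v∈ker : InKernel A B (onPoints _≟ᵥ_ B v)
    v∈ker a∈ = trans (cong (λ a → ∑[ b ∈ B ] (Tentry a b * onPoints _≟ᵥ_ B v b)) (lookup-index a∈))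
      (trans (sym (Σℚ-lookup _≟ᵥ_ uniq (Tentry (lookup A (index a∈))) v)) (Tv≡0 (index a∈)))

ColIndep⇒FullRank : ∀ {r c} (X : Matrix r c) → c ≤ r → ColIndep X → FullRank X
ColIndep⇒FullRank {r} {c} X c≤r indep with c ≤? r
... | yes _   = indep
... | no c≰r  = contradiction c≤r c≰r

lemma28 : (m d : ℕ) (B : List (Vec ℕ (suc m)))
          → Unique B → B ≢ [] → All (λ a → norm1 a ≤ d) B
          → FullRank (Tsub (findCone m B) B)
lemma28 m d B uniq _ _ =
  ColIndep⇒FullRank (Tsub (findCone m B) B) (ℕP.≤-reflexive (sym (length-findCone m B)))
    (Tsub-ColIndep (findCone m B) B uniq (findCone-kernelTrivial m B uniq))
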